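{- Let $G=\mathbb{Z}\oplus\mathbb{Z}/\mu_1\mathbb{Z}\oplus\dots\oplus\mathbb{Z}/\mu_r\mathbb{Z}$ be in invariant factor form with $r\ge 1$, and let $Q=[\omega_0,\dots,\omega_n]$, $\omega_i=(w_i,\eta_i)$, be a degree matrix in $G$. Let $\zeta$ and $\theta$ be torsion vectors of orders $\mu\ge2$ and $\nu\ge2$, respectively, for $w=[w_0,\dots,w_n]$. Let $Q_\zeta$ (resp. $Q_\theta$) be the matrix obtained from $Q$ by appending $\zeta$ (resp. $\theta$) as a new last row, and $(Q_\zeta)_\theta$ the matrix obtained from $Q_\zeta$ by appending $\theta$ as a new last row. If $Q_\zeta$ is a degree matrix in $G\oplus\mathbb{Z}/\mu\mathbb{Z}$ with this group in invariant factor form, and $Q_\theta$ is not a degree matrix in $G\oplus\mathbb{Z}/\nu\mathbb{Z}$ with this group in invariant factor form, then $(Q_\zeta)_\theta$ is not a degree matrix in $G\oplus\mathbb{Z}/\mu\mathbb{Z}\oplus\mathbb{Z}/\nu\mathbb{Z}$ with this group in invariant factor form.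
   Context: Invariant factor form: $\mathbb{Z}\oplus\mathbb{Z}/\mu_1\mathbb{Z}\oplus\dots\oplus\mathbb{Z}/\mu_s\mathbb{Z}$ with integers $\mu_i\ge2$ and $\mu_s\mid\mu_{s-1}\mid\dots\mid\mu_1$. A degree matrix in such a group $H$ is a matrix $[\omega_0,\dots,\omega_n]$ with columns $\omega_i=(w_i,\ldots)\in H$, $w_i\in\mathbb{Z}_{\ge1}$, such that any $n$ of the columns generate $H$ (equivalently, it is the degree matrix of a fake weighted projective space with class group $H$). For a vector $w\in\mathbb{Z}_{\ge1}^{n+1}$ which is a degree matrix in $\mathbb{Z}$ and $\mu\ge2$, a torsion vector of order $\mu$ for $w$ is a vector $\zeta\in(\mathbb{Z}/\mu\mathbb{Z})^{n+1}$ such that the matrix with rows $w$ and $\zeta$ is a degree matrix in $\mathbb{Z}\oplus\mathbb{Z}/\mu\mathbb{Z}$. -}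

module Defs where

open import Data.Nat as ℕ using (ℕ; zero; suc)
open import Data.Integer as ℤ using (ℤ; +_; _+_; _*_; _-_)
open import Data.Integer.Divisibility as ℤD using ()
open import Data.Nat.Divisibility as ℕD using ()
open import Data.Fin using (Fin; zero; suc)
open import Data.Vec using (Vec; []; _∷_; lookup; _∷ʳ_)
open import Data.Product using (Σ; _×_; ∃)
open import Data.Unit using (⊤)
open import Relation.Binary.PropositionalEquality using (_≡_)

Σℤ : ∀ {m} → (Fin m → ℤ) → ℤ
Σℤ {zero}  f = + 0
Σℤ {suc m} f = f zero + Σℤ (λ i → f (suc i))

_≡[mod_]_ : ℤ → ℕ → ℤ → Set
a ≡[mod m ] b = (+ m) ℤD.∣ (a - b)

InvariantFactorForm : ∀ {k} → Vec ℕ k → Set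
InvariantFactorForm []                = ⊤
InvariantFactorForm (m ∷ [])          = 2 ℕ.≤ m
InvariantFactorForm (m ∷ (m′ ∷ ms))   =
  (2 ℕ.≤ m) × (m′ ℕD.∣ m) × InvariantFactorForm (m′ ∷ ms)

-- Group H = ℤ ⊕ ℤ/μ₁ ⊕ … ⊕ ℤ/μₖ (given by μs : Vec ℕ k).
-- A matrix with n+1 columns ωⱼ = (w j, η₁ j, …, ηₖ j) ∈ H is given by
-- the free row w and the torsion rows η (a Vec of k rows, the l-th row
-- read modulo the l-th entry of μs).
GenerateWithout : ∀ {n k} → Vec ℕ k → (Fin (suc n) → ℤ) →
                  Vec (Fin (suc n) → ℤ) k → Fin (suc n) → Set
GenerateWithout {n} {k} μs w η i =
  (a : ℤ) (t : Vec ℤ k) →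
  Σ (Fin (suc n) → ℤ) λ c →
    (c i ≡ + 0) ×
    (Σℤ (λ j → c j * w j) ≡ a) ×
    ((l : Fin k) →
      Σℤ (λ j → c j * lookup η l j) ≡[mod lookup μs l ] lookup t l)

DegreeMatrix : ∀ {n k} → Vec ℕ k → (Fin (suc n) → ℤ) →
               Vec (Fin (suc n) → ℤ) k → Set
DegreeMatrix μs w η =
  ((j : _) → + 1 ℤ.≤ w j) × ((i : _) → GenerateWithout μs w η i)

DegreeMatrixIFF : ∀ {n k} → Vec ℕ k → (Fin (suc n) → ℤ) →
                  Vec (Fin (suc n) → ℤ) k → Set
DegreeMatrixIFF μs w η = InvariantFactorForm μs × DegreeMatrix μs w η

-- ζ is a torsion vector of order μ ≥ 2 for w: [w; ζ] is a degree matrix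
-- in ℤ ⊕ ℤ/μ.  (Entries of ζ are integer representatives of classes mod μ.)
TorsionVector : ∀ {n} → ℕ → (Fin (suc n) → ℤ) → (Fin (suc n) → ℤ) → Set
TorsionVector μ w ζ =
  (2 ℕ.≤ μ) × DegreeMatrix (μ ∷ []) w (ζ ∷ [])

{-# OPTIONS --safe #-}
-- Deleting the ζ-row of (Q_ζ)_θ gives Q_θ: the projection
-- G ⊕ ℤ/μ ⊕ ℤ/ν → G ⊕ ℤ/ν maps each column of (Q_ζ)_θ to the matching column
-- of Q_θ, so any n columns generating the source generate the target, and
-- deleting an invariant factor keeps the divisibility chain by transitivity.
-- Hence (Q_ζ)_θ being a degree matrix would make Q_θ one.
module Submission where

open import Defs
open import Data.Nat using (ℕ; suc)
open import Data.Nat.Divisibility using (∣-trans)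
open import Data.Integer using (ℤ; +_; _*_)
open import Data.Fin using (Fin; zero; suc; fromℕ; inject₁; punchIn)
open import Data.Vec using (Vec; []; _∷_; _∷ʳ_; lookup; insertAt)
open import Data.Vec.Properties using (insertAt-punchIn)
open import Data.Product using (_,_)
open import Data.Unit using (tt)
open import Relation.Nullary using (¬_)
open import Relation.Binary.PropositionalEquality using (_≡_; refl; cong; subst; subst₂)

∷ʳ-∷ʳ≡insertAt : ∀ {a} {A : Set a} {k} (xs : Vec A k) (x y : A) →
                 (xs ∷ʳ x) ∷ʳ y ≡ insertAt (xs ∷ʳ y) (inject₁ (fromℕ k)) x
∷ʳ-∷ʳ≡insertAt []       x y = refl
∷ʳ-∷ʳ≡insertAt (z ∷ xs) x y = cong (z ∷_) (∷ʳ-∷ʳ≡insertAt xs x y)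

InvariantFactorForm-tail : ∀ {k} (m : ℕ) (μs : Vec ℕ k) →
                           InvariantFactorForm (m ∷ μs) → InvariantFactorForm μs
InvariantFactorForm-tail m []       _ = tt
InvariantFactorForm-tail m (_ ∷ _) (_ , _ , iff) = iff

InvariantFactorForm-insertAt⁻ : ∀ {k} (μs : Vec ℕ k) (p : Fin (suc k)) (m : ℕ) →
                                InvariantFactorForm (insertAt μs p m) →
                                InvariantFactorForm μs
InvariantFactorForm-insertAt⁻ μs           zero          m iff = InvariantFactorForm-tail m μs iff
InvariantFactorForm-insertAt⁻ (x ∷ [])     (suc zero)    m (2≤x , _) = 2≤x
InvariantFactorForm-insertAt⁻ (x ∷ y ∷ ys) (suc zero)    m (2≤x , m∣x , _ , y∣m , iff) =
  2≤x , ∣-trans y∣m m∣x , iff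
InvariantFactorForm-insertAt⁻ (x ∷ y ∷ ys) (suc (suc p)) m (2≤x , y∣x , iff) =
  2≤x , y∣x , InvariantFactorForm-insertAt⁻ (y ∷ ys) (suc p) m iff

module _ {n k} (μs : Vec ℕ k) (w : Fin (suc n) → ℤ) (η : Vec (Fin (suc n) → ℤ) k)
         (p : Fin (suc k)) (m : ℕ) (ζ : Fin (suc n) → ℤ) where

  -- A target t is reached by asking for 0 in the inserted row; the other rows
  -- sit at the punched-in positions.
  GenerateWithout-insertAt⁻ : ∀ i → GenerateWithout (insertAt μs p m) w (insertAt η p ζ) i →
                              GenerateWithout μs w η i
  GenerateWithout-insertAt⁻ i gen a t with gen a (insertAt t p (+ 0))
  ... | c , cᵢ≡0 , c·w≡a , c·η≡t = c , cᵢ≡0 , c·w≡a , λ l →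
    subst₂ (λ row target → Σℤ (λ j → c j * row j) ≡[mod lookup μs l ] target)
      (insertAt-punchIn η p ζ l) (insertAt-punchIn t p (+ 0) l)
      (subst (λ modulus → Σℤ (λ j → c j * lookup (insertAt η p ζ) (punchIn p l) j)
                            ≡[mod modulus ] lookup (insertAt t p (+ 0)) (punchIn p l))
        (insertAt-punchIn μs p m l) (c·η≡t (punchIn p l)))

  DegreeMatrixIFF-insertAt⁻ : DegreeMatrixIFF (insertAt μs p m) w (insertAt η p ζ) →
                              DegreeMatrixIFF μs w η
  DegreeMatrixIFF-insertAt⁻ (iff , w≥1 , gen) =
    InvariantFactorForm-insertAt⁻ μs p m iff , w≥1 , λ i → GenerateWithout-insertAt⁻ i (gen i)

corollary4p12 : ∀ {n r} (μs : Vec ℕ (suc r)) (w : Fin (suc n) → ℤ)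
    (η : Vec (Fin (suc n) → ℤ) (suc r)) (μ ν : ℕ) (ζ θ : Fin (suc n) → ℤ) →
    DegreeMatrixIFF μs w η →
    TorsionVector μ w ζ →
    TorsionVector ν w θ →
    DegreeMatrixIFF (μs ∷ʳ μ) w (η ∷ʳ ζ) →
    ¬ DegreeMatrixIFF (μs ∷ʳ ν) w (η ∷ʳ θ) →
    ¬ DegreeMatrixIFF ((μs ∷ʳ μ) ∷ʳ ν) w ((η ∷ʳ ζ) ∷ʳ θ)
corollary4p12 {r = r} μs w η μ ν ζ θ _ _ _ _ ¬Qθ Qζθ =
  ¬Qθ (DegreeMatrixIFF-insertAt⁻ (μs ∷ʳ ν) w (η ∷ʳ θ) (inject₁ (fromℕ (suc r))) μ ζ
        (subst₂ (λ μs′ η′ → DegreeMatrixIFF μs′ w η′)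
          (∷ʳ-∷ʳ≡insertAt μs μ ν) (∷ʳ-∷ʳ≡insertAt η ζ θ) Qζθ))
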